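{- Let $\mathcal{B}(4)=\{(d,c,b,a)\in\mathbb{Z}^4: 0\le d<c<b<a\}$. Call $t_0=(0,c,b,a)\in\mathcal{B}(4)$ initial if $a$ and $c$ are odd; it is of the first kind if $b$ is even and of the second kind if $b$ is odd. Set $v_{t_0}=(0,1,2,3)$ for $t_0$ of the first kind and $v_{t_0}=(0,3,2,1)$ for $t_0$ of the second kind, and let \[ P(t_0,v_{t_0})=\Big\{\,t_0+\Big\lfloor \tfrac{1}{4}\big(v_{t_0}+k(1,1,1,1)\big)\Big\rfloor \;:\; k\in\mathbb{Z}_{\ge 0}\Big\}, \] the floor being taken entrywise. Then the sets $P(t_0,v_{t_0})$, for $t_0$ ranging over all initial tableaux, are pairwise disjoint subsets of $\mathcal{B}(4)$ whose union is $\mathcal{B}(4)$.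
   Context: Elements $(d,c,b,a)$ of $\mathcal{B}(4)$ encode column tableaux (strictly increasing quadruples) indexing a basis of $\Lambda^4\mathrm{Sym}^r\mathbb{C}^2$ for $a\le r$. -}

module Defs where

open import Data.Nat using (ℕ; zero; suc; _+_; _<_; _%_; _/_; _≡ᵇ_)
open import Data.Bool using (if_then_else_)
open import Data.Product using (Σ; _×_; _,_; ∃-syntax)
open import Relation.Binary.PropositionalEquality using (_≡_)

-- A quadruple (d , c , b , a) of natural numbers.
-- (Entries of elements of B(4) are integers ≥ 0, so ℕ suffices.)
Quad : Set
Quad = ℕ × ℕ × ℕ × ℕ

InB4 : Quad → Set
InB4 (d , c , b , a) = d < c × c < b × b < a

Initial : Quad → Set
Initial (d , c , b , a) =
  d ≡ 0 × InB4 (d , c , b , a) × c % 2 ≡ 1 × a % 2 ≡ 1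

vOf : Quad → Quad
vOf (d , c , b , a) =
  if b % 2 ≡ᵇ 0 then (0 , 1 , 2 , 3) else (0 , 3 , 2 , 1)

shift : Quad → Quad → ℕ → Quad
shift (d , c , b , a) (v₁ , v₂ , v₃ , v₄) k =
  ( d + (v₁ + k) / 4
  , c + (v₂ + k) / 4
  , b + (v₃ + k) / 4
  , a + (v₄ + k) / 4 )

InP : Quad → Quad → Set
InP t₀ t = ∃[ k ] t ≡ shift t₀ (vOf t₀) k

{-# OPTIONS --safe #-}
module Submission where

-- Write k = r + 4q with r < 4. The element of P(t₀, v_{t₀}) of index k is
-- t₀ + (0, δ(κ, r)) + q(1,1,1,1), where κ is the parity of b (the kind of t₀) and
-- δ(κ, r) = ⌊(v + r)/4⌋ ∈ {0,1}³ is a step that is increasing in the first kind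
-- and decreasing in the second. A decrease only happens between entries of
-- equal parity, which are at distance at least 2; so the chain stays in B(4).
-- Subtracting the first entry d leaves the shape (c - d, b - d, a - d) =
-- (c₀, b₀, a₀) + δ(κ, r), whose parities are (1, κ, 1) + δ(κ, r) mod 2. The
-- eight pairs (κ, r) give the eight parity patterns exactly once. So the shape
-- of t determines (κ, r), hence δ and t₀, which gives disjointness. For
-- t ∈ B(4), reading (κ, r) off its shape and subtracting δ gives an initial
-- tableau whose chain contains t.

open import Defs
open import Data.Product using (_×_; _,_; ∃-syntax; proj₁; proj₂)
open import Data.Product.Properties using (×-≡,≡←≡)
open import Relation.Binary.PropositionalEquality
  using (_≡_; _≢_; ≢-sym; refl; sym; trans; cong; cong₂; subst; module ≡-Reasoning)
open import Data.Nat using (ℕ; suc; NonZero; _+_; _*_; _∸_; _<_; _≤_; _%_; _/_; z≤n; s≤s; parity)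
open import Data.Nat.Properties
  using ( ≤-trans; <-trans; <-≤-trans; <⇒≤; ≤-pred; ≤∧≢⇒<; n≤1+n; m<n⇒m<1+n; m≤m+n
        ; +-assoc; +-comm; +-monoʳ-≤; +-monoʳ-<; +-monoˡ-<; +-mono-<-≤; +-cancelʳ-<
        ; m+n∸n≡m; m∸n+n≡m; module ≤-Reasoning)
open import Data.Nat.Divisibility using (n∣m*n)
open import Data.Nat.DivMod
  using (_divMod_; result; +-distrib-/-∣ʳ; m*n/n≡m; m<n⇒m/n≡0; /-monoˡ-≤; m<n*o⇒m/o<n)
open import Data.Fin using (Fin; toℕ)
open import Data.Fin.Patterns using (0F; 1F; 2F; 3F)
open import Data.Fin.Properties using (toℕ<n)
open import Data.Parity using (Parity; 0ℙ; 1ℙ) renaming (_+_ to _+ℙ_)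
open import Data.Parity.Properties using (+-homo-+; +-cancelʳ-≡; p≢p⁻¹; suc-homo-⁻¹)
open import Function.Bundles using (_⇔_; mk⇔; Equivalence)

%2≡1⇒parity≡1ℙ : ∀ n → n % 2 ≡ 1 → parity n ≡ 1ℙ
%2≡1⇒parity≡1ℙ 1             _ = refl
%2≡1⇒parity≡1ℙ (suc (suc n)) h = %2≡1⇒parity≡1ℙ n h

parity≡1ℙ⇒%2≡1 : ∀ n → parity n ≡ 1ℙ → n % 2 ≡ 1
parity≡1ℙ⇒%2≡1 1             _ = refl
parity≡1ℙ⇒%2≡1 (suc (suc n)) h = parity≡1ℙ⇒%2≡1 n h

parity≡1ℙ⇒0< : ∀ {n} → parity n ≡ 1ℙ → 0 < n
parity≡1ℙ⇒0< {suc _} _ = s≤s z≤n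

parity[n]≢parity[1+n] : ∀ n → parity n ≢ parity (suc n)
parity[n]≢parity[1+n] n eq = p≢p⁻¹ (parity (suc n)) (sym (trans (suc-homo-⁻¹ n) eq))

odd≢even : ∀ {x y} → parity x ≡ 1ℙ → parity y ≡ 0ℙ → x ≢ y
odd≢even x-odd y-even refl with trans (sym x-odd) y-even
... | ()

parity-+ : ∀ {p} x δ → parity x ≡ p → parity (x + δ) ≡ p +ℙ parity δ
parity-+ x δ eq = trans (+-homo-+ x δ) (cong (_+ℙ parity δ) eq)

parity-+-cancel : ∀ {p} x δ → parity (x + δ) ≡ p +ℙ parity δ → parity x ≡ p
parity-+-cancel {p} x δ eq = +-cancelʳ-≡ (parity δ) (parity x) p (trans (sym (+-homo-+ x δ)) eq)

sameParity⇒1+< : ∀ {x y} → parity x ≡ parity y → x < y → suc x < y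
sameParity⇒1+< {x} eq x<y =
  ≤∧≢⇒< x<y (λ 1+x≡y → parity[n]≢parity[1+n] x (trans eq (cong parity (sym 1+x≡y))))

+-mono-<-sameParity : ∀ {x y i} j → parity x ≡ parity y → x < y → i ≤ 1 → x + i < y + j
+-mono-<-sameParity {x} {y} {i} j eq x<y i≤1 = begin-strict
  x + i  ≤⟨ +-monoʳ-≤ x i≤1 ⟩
  x + 1  ≡⟨ +-comm x 1 ⟩
  suc x  <⟨ sameParity⇒1+< eq x<y ⟩
  y      ≤⟨ m≤m+n y j ⟩
  y + j  ∎
  where open ≤-Reasoning

+-cancel-<-≢ : ∀ {x y} i {j} → x + i < y + j → j ≤ 1 → x ≢ y → x < y
+-cancel-<-≢ {x} {y} i {j} x+i<y+j j≤1 = ≤∧≢⇒< (≤-pred (begin-strict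
  x      ≤⟨ m≤m+n x i ⟩
  x + i  <⟨ x+i<y+j ⟩
  y + j  ≤⟨ +-monoʳ-≤ y j≤1 ⟩
  y + 1  ≡⟨ +-comm y 1 ⟩
  suc y  ∎))
  where open ≤-Reasoning

+-cancel-<-≥ : ∀ {x y i j} → x + i < y + j → j ≤ i → x < y
+-cancel-<-≥ {x} {y} {i} {j} x+i<y+j j≤i = +-cancelʳ-< j x y (begin-strict
  x + j  ≤⟨ +-monoʳ-≤ x j≤i ⟩
  x + i  <⟨ x+i<y+j ⟩
  y + j  ∎)
  where open ≤-Reasoning

[m+kn]/n≡m/n+k : ∀ m k n .{{_ : NonZero n}} → (m + k * n) / n ≡ m / n + k
[m+kn]/n≡m/n+k m k n = trans (+-distrib-/-∣ʳ m (n∣m*n k)) (cong (m / n +_) (m*n/n≡m k n))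

Shape : Set
Shape = ℕ × ℕ × ℕ

_⊕_ : Shape → Shape → Shape
(x₁ , x₂ , x₃) ⊕ (y₁ , y₂ , y₃) = x₁ + y₁ , x₂ + y₂ , x₃ + y₃

_⊖_ : Shape → Shape → Shape
(x₁ , x₂ , x₃) ⊖ (y₁ , y₂ , y₃) = x₁ ∸ y₁ , x₂ ∸ y₂ , x₃ ∸ y₃

⊕-⊖ : ∀ x y → (x ⊕ y) ⊖ y ≡ x
⊕-⊖ (x₁ , x₂ , x₃) (y₁ , y₂ , y₃) =
  cong₂ _,_ (m+n∸n≡m x₁ y₁) (cong₂ _,_ (m+n∸n≡m x₂ y₂) (m+n∸n≡m x₃ y₃))

shape : Quad → Shape
shape (d , c , b , a) = c ∸ d , b ∸ d , a ∸ d

atLevel : ℕ → Shape → Quad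
atLevel q (y₁ , y₂ , y₃) = q , y₁ + q , y₂ + q , y₃ + q

shape-atLevel : ∀ q y → shape (atLevel q y) ≡ y
shape-atLevel q (y₁ , y₂ , y₃) =
  cong₂ _,_ (m+n∸n≡m y₁ q) (cong₂ _,_ (m+n∸n≡m y₂ q) (m+n∸n≡m y₃ q))

atLevel-shape : ∀ {t} → InB4 t → atLevel (proj₁ t) (shape t) ≡ t
atLevel-shape {d , c , b , a} (d<c , c<b , b<a) =
  cong₂ _,_ refl (cong₂ _,_ (m∸n+n≡m d≤c) (cong₂ _,_ (m∸n+n≡m d≤b) (m∸n+n≡m d≤a)))
  where
  d≤c = <⇒≤ d<c
  d≤b = <⇒≤ (<-trans d<c c<b)
  d≤a = <⇒≤ (<-trans (<-trans d<c c<b) b<a)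

InB4-atLevel : ∀ q {y} → InB4 (0 , y) ⇔ InB4 (atLevel q y)
InB4-atLevel q = mk⇔
  (λ (h₁ , h₂ , h₃) → +-monoˡ-< q h₁ , +-monoˡ-< q h₂ , +-monoˡ-< q h₃)
  (λ (h₁ , h₂ , h₃) → +-cancelʳ-< q _ _ h₁ , +-cancelʳ-< q _ _ h₂ , +-cancelʳ-< q _ _ h₃)

InB4-shape : ∀ {t} → InB4 t → InB4 (0 , shape t)
InB4-shape {t} t∈B =
  Equivalence.from (InB4-atLevel (proj₁ t)) (subst InB4 (sym (atLevel-shape t∈B)) t∈B)

direction : Parity → Shape
direction 0ℙ = 1 , 2 , 3
direction 1ℙ = 3 , 2 , 1

vOf-kind : ∀ {κ} d c b a → parity b ≡ κ → vOf (d , c , b , a) ≡ (0 , direction κ)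
vOf-kind d c 0             a refl = refl
vOf-kind d c 1             a refl = refl
vOf-kind d c (suc (suc b)) a eq   = vOf-kind d c b a eq

-- The kind of t₀ (as the parity of b) and the index k modulo 4.
Class : Set
Class = Parity × Fin 4

offset : Class → Shape
offset (κ , r) = let (v₁ , v₂ , v₃) = direction κ in
  (v₁ + toℕ r) / 4 , (v₂ + toℕ r) / 4 , (v₃ + toℕ r) / 4

offset-step : ∀ v k → (v + k) / 4 ≤ (suc v + k) / 4
offset-step v k = /-monoˡ-≤ 4 (n≤1+n (v + k))

offset-top : ∀ (r : Fin 4) → (3 + toℕ r) / 4 ≤ 1
offset-top r = ≤-pred (m<n*o⇒m/o<n {n = 2} {o = 4} (m<n⇒m<1+n (+-monoʳ-< 3 (toℕ<n r))))

offset-≤1 : ∀ κ r → let (δ₁ , δ₂ , δ₃) = offset (κ , r) in δ₁ ≤ 1 × δ₂ ≤ 1 × δ₃ ≤ 1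
offset-≤1 0ℙ r = ≤-trans (offset-step 1 (toℕ r)) δ₂≤1 , δ₂≤1 , offset-top r
  where δ₂≤1 = ≤-trans (offset-step 2 (toℕ r)) (offset-top r)
offset-≤1 1ℙ r = offset-top r , δ₂≤1 , ≤-trans (offset-step 1 (toℕ r)) δ₂≤1
  where δ₂≤1 = ≤-trans (offset-step 2 (toℕ r)) (offset-top r)

shift-atLevel : ∀ x κ r q →
  shift (0 , x) (0 , direction κ) (toℕ r + q * 4) ≡ atLevel q (x ⊕ offset (κ , r))
shift-atLevel (x₁ , x₂ , x₃) κ r q =
  cong₂ _,_ level (cong₂ _,_ (entry x₁ v₁) (cong₂ _,_ (entry x₂ v₂) (entry x₃ v₃)))
  where
  open ≡-Reasoning
  v₁ = proj₁ (direction κ)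
  v₂ = proj₁ (proj₂ (direction κ))
  v₃ = proj₂ (proj₂ (direction κ))
  level : (toℕ r + q * 4) / 4 ≡ q
  level = trans ([m+kn]/n≡m/n+k (toℕ r) q 4) (cong (_+ q) (m<n⇒m/n≡0 (toℕ<n r)))
  entry : ∀ y v → y + (v + (toℕ r + q * 4)) / 4 ≡ y + (v + toℕ r) / 4 + q
  entry y v = begin
    y + (v + (toℕ r + q * 4)) / 4  ≡⟨ cong (λ m → y + m / 4) (sym (+-assoc v (toℕ r) (q * 4))) ⟩
    y + (v + toℕ r + q * 4) / 4    ≡⟨ cong (y +_) ([m+kn]/n≡m/n+k (v + toℕ r) q 4) ⟩
    y + ((v + toℕ r) / 4 + q)      ≡⟨ sym (+-assoc y _ q) ⟩
    y + (v + toℕ r) / 4 + q        ∎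

InitialParity : Parity → Shape → Set
InitialParity κ (c , b , a) = parity c ≡ 1ℙ × parity b ≡ κ × parity a ≡ 1ℙ

Initial⇒InitialParity : ∀ {c b a} → Initial (0 , c , b , a) → InitialParity (parity b) (c , b , a)
Initial⇒InitialParity {c} {b} {a} (_ , _ , c-odd , a-odd) =
  %2≡1⇒parity≡1ℙ c c-odd , refl , %2≡1⇒parity≡1ℙ a a-odd

InitialParity⇒Initial : ∀ {κ c b a} →
  InitialParity κ (c , b , a) → InB4 (0 , c , b , a) → Initial (0 , c , b , a)
InitialParity⇒Initial {c = c} {a = a} (c-odd , _ , a-odd) x∈B =
  refl , x∈B , parity≡1ℙ⇒%2≡1 c c-odd , parity≡1ℙ⇒%2≡1 a a-odd

shift-vOf : ∀ {κ} x r q → InitialParity κ x →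
  shift (0 , x) (vOf (0 , x)) (toℕ r + q * 4) ≡ atLevel q (x ⊕ offset (κ , r))
shift-vOf {κ} x@(c , b , a) r q (_ , b≡κ , _) =
  trans (cong (λ v → shift (0 , x) v (toℕ r + q * 4)) (vOf-kind 0 c b a b≡κ)) (shift-atLevel x κ r q)

InP⇒atLevel : ∀ {κ} x {t} → InitialParity κ x → InP (0 , x) t →
  ∃[ q ] ∃[ r ] t ≡ atLevel q (x ⊕ offset (κ , r))
InP⇒atLevel x x-par (k , refl) with k divMod 4
... | result q r refl = q , r , shift-vOf x r q x-par

atLevel⇒InP : ∀ {κ} x → InitialParity κ x → ∀ q r → InP (0 , x) (atLevel q (x ⊕ offset (κ , r)))
atLevel⇒InP x x-par q r = toℕ r + q * 4 , sym (shift-vOf x r q x-par)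

InB4-⊕offset : ∀ κ r {x} → InitialParity κ x → InB4 (0 , x) ⇔ InB4 (0 , x ⊕ offset (κ , r))
InB4-⊕offset 0ℙ r {x₁ , x₂ , x₃} (x₁-odd , x₂-even , x₃-odd) = mk⇔
  (λ (0<x₁ , x₁<x₂ , x₂<x₃) →
     <-≤-trans 0<x₁ (m≤m+n x₁ _) ,
     +-mono-<-≤ x₁<x₂ (offset-step 1 (toℕ r)) ,
     +-mono-<-≤ x₂<x₃ (offset-step 2 (toℕ r)))
  (λ (_ , h₁₂ , h₂₃) →
     parity≡1ℙ⇒0< x₁-odd ,
     +-cancel-<-≢ _ h₁₂ δ₂≤1 (odd≢even x₁-odd x₂-even) ,
     +-cancel-<-≢ _ h₂₃ δ₃≤1 (≢-sym (odd≢even x₃-odd x₂-even)))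
  where
  δ₂≤1 = proj₁ (proj₂ (offset-≤1 0ℙ r))
  δ₃≤1 = proj₂ (proj₂ (offset-≤1 0ℙ r))
InB4-⊕offset 1ℙ r {x₁ , x₂ , x₃} (x₁-odd , x₂-odd , x₃-odd) = mk⇔
  (λ (0<x₁ , x₁<x₂ , x₂<x₃) →
     <-≤-trans 0<x₁ (m≤m+n x₁ _) ,
     +-mono-<-sameParity _ (trans x₁-odd (sym x₂-odd)) x₁<x₂ δ₁≤1 ,
     +-mono-<-sameParity _ (trans x₂-odd (sym x₃-odd)) x₂<x₃ δ₂≤1)
  (λ (_ , h₁₂ , h₂₃) →
     parity≡1ℙ⇒0< x₁-odd ,
     +-cancel-<-≥ h₁₂ (offset-step 2 (toℕ r)) ,
     +-cancel-<-≥ h₂₃ (offset-step 1 (toℕ r)))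
  where
  δ₁≤1 = proj₁ (offset-≤1 1ℙ r)
  δ₂≤1 = proj₁ (proj₂ (offset-≤1 1ℙ r))

⊖offset-⊕offset : ∀ cl {n} → InB4 (0 , n) → (n ⊖ offset cl) ⊕ offset cl ≡ n
⊖offset-⊕offset (κ , r) {n₁ , n₂ , n₃} (0<n₁ , n₁<n₂ , n₂<n₃) with offset-≤1 κ r
... | δ₁≤1 , δ₂≤1 , δ₃≤1 =
  cong₂ _,_ (m∸n+n≡m (≤-trans δ₁≤1 0<n₁))
    (cong₂ _,_ (m∸n+n≡m (≤-trans δ₂≤1 0<n₂)) (m∸n+n≡m (≤-trans δ₃≤1 (<-trans 0<n₂ n₂<n₃))))
  where 0<n₂ = <-trans 0<n₁ n₁<n₂

Parities : Set
Parities = Parity × Parity × Parity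

parities : Shape → Parities
parities (n₁ , n₂ , n₃) = parity n₁ , parity n₂ , parity n₃

signature : Class → Parities
signature (κ , r) = let (δ₁ , δ₂ , δ₃) = offset (κ , r) in
  1ℙ +ℙ parity δ₁ , κ +ℙ parity δ₂ , 1ℙ +ℙ parity δ₃

classify : Parities → Class
classify (1ℙ , 0ℙ , 1ℙ) = 0ℙ , 0F
classify (1ℙ , 0ℙ , 0ℙ) = 0ℙ , 1F
classify (1ℙ , 1ℙ , 0ℙ) = 0ℙ , 2F
classify (0ℙ , 1ℙ , 0ℙ) = 0ℙ , 3F
classify (1ℙ , 1ℙ , 1ℙ) = 1ℙ , 0F
classify (0ℙ , 1ℙ , 1ℙ) = 1ℙ , 1F
classify (0ℙ , 0ℙ , 1ℙ) = 1ℙ , 2F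
classify (0ℙ , 0ℙ , 0ℙ) = 1ℙ , 3F

classify-signature : ∀ cl → classify (signature cl) ≡ cl
classify-signature (0ℙ , 0F) = refl
classify-signature (0ℙ , 1F) = refl
classify-signature (0ℙ , 2F) = refl
classify-signature (0ℙ , 3F) = refl
classify-signature (1ℙ , 0F) = refl
classify-signature (1ℙ , 1F) = refl
classify-signature (1ℙ , 2F) = refl
classify-signature (1ℙ , 3F) = refl

signature-classify : ∀ s → signature (classify s) ≡ s
signature-classify (1ℙ , 0ℙ , 1ℙ) = refl
signature-classify (1ℙ , 0ℙ , 0ℙ) = refl
signature-classify (1ℙ , 1ℙ , 0ℙ) = refl
signature-classify (0ℙ , 1ℙ , 0ℙ) = refl
signature-classify (1ℙ , 1ℙ , 1ℙ) = refl
signature-classify (0ℙ , 1ℙ , 1ℙ) = refl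
signature-classify (0ℙ , 0ℙ , 1ℙ) = refl
signature-classify (0ℙ , 0ℙ , 0ℙ) = refl

InitialParity⇔parities-⊕offset : ∀ κ r x →
  InitialParity κ x ⇔ parities (x ⊕ offset (κ , r)) ≡ signature (κ , r)
InitialParity⇔parities-⊕offset κ r (x₁ , x₂ , x₃) = mk⇔
  (λ (e₁ , e₂ , e₃) →
     cong₂ _,_ (parity-+ x₁ δ₁ e₁) (cong₂ _,_ (parity-+ x₂ δ₂ e₂) (parity-+ x₃ δ₃ e₃)))
  (λ eq → let (e₁ , e₂₃) = ×-≡,≡←≡ eq ; (e₂ , e₃) = ×-≡,≡←≡ e₂₃ in
     parity-+-cancel x₁ δ₁ e₁ , parity-+-cancel x₂ δ₂ e₂ , parity-+-cancel x₃ δ₃ e₃)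
  where
  δ₁ = proj₁ (offset (κ , r))
  δ₂ = proj₁ (proj₂ (offset (κ , r)))
  δ₃ = proj₂ (proj₂ (offset (κ , r)))

initialOf : Shape → Quad
initialOf n = 0 , n ⊖ offset (classify (parities n))

initialOf-⊕offset : ∀ κ r x → InitialParity κ x → initialOf (x ⊕ offset (κ , r)) ≡ (0 , x)
initialOf-⊕offset κ r x x-par = begin
  0 , (x ⊕ δ) ⊖ offset (classify (parities (x ⊕ δ)))
    ≡⟨ cong (λ s → 0 , (x ⊕ δ) ⊖ offset (classify s))
            (Equivalence.to (InitialParity⇔parities-⊕offset κ r x) x-par) ⟩
  0 , (x ⊕ δ) ⊖ offset (classify (signature (κ , r)))
    ≡⟨ cong (λ cl → 0 , (x ⊕ δ) ⊖ offset cl) (classify-signature (κ , r)) ⟩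
  0 , (x ⊕ δ) ⊖ δ
    ≡⟨ cong (0 ,_) (⊕-⊖ x δ) ⟩
  0 , x ∎
  where
  open ≡-Reasoning
  δ = offset (κ , r)

InP⇒InB4 : (t₀ t : Quad) → Initial t₀ → InP t₀ t → InB4 t
InP⇒InB4 (_ , x) t t₀-init@(refl , x∈B , _) t∈P
  with q , r , refl ← InP⇒atLevel x (Initial⇒InitialParity t₀-init) t∈P =
  Equivalence.to (InB4-atLevel q)
    (Equivalence.to (InB4-⊕offset _ r (Initial⇒InitialParity t₀-init)) x∈B)

InP⇒initialOf : ∀ {t₀ t} → Initial t₀ → InP t₀ t → initialOf (shape t) ≡ t₀
InP⇒initialOf {_ , x} t₀-init@(refl , _) t∈P
  with q , r , refl ← InP⇒atLevel x (Initial⇒InitialParity t₀-init) t∈P =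
  trans (cong initialOf (shape-atLevel q _)) (initialOf-⊕offset _ r x (Initial⇒InitialParity t₀-init))

InB4⇒InP-initialOf : ∀ {t} → InB4 t → Initial (initialOf (shape t)) × InP (initialOf (shape t)) t
InB4⇒InP-initialOf {t@(d , _)} t∈B =
  InitialParity⇒Initial x-par x∈B ,
  subst (InP (0 , x)) (trans (cong (atLevel d) x⊕δ≡n) (atLevel-shape t∈B)) (atLevel⇒InP x x-par d r)
  where
  n = shape t
  n∈B = InB4-shape t∈B
  cl = classify (parities n)
  κ = proj₁ cl
  r = proj₂ cl
  x = n ⊖ offset cl
  x⊕δ≡n : x ⊕ offset cl ≡ n
  x⊕δ≡n = ⊖offset-⊕offset cl n∈B
  x-par : InitialParity κ x
  x-par = Equivalence.from (InitialParity⇔parities-⊕offset κ r x)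
    (trans (cong parities x⊕δ≡n) (sym (signature-classify (parities n))))
  x∈B : InB4 (0 , x)
  x∈B = Equivalence.from (InB4-⊕offset κ r x-par) (subst (λ y → InB4 (0 , y)) (sym x⊕δ≡n) n∈B)

lemma5p7 :
    ((t₀ t : Quad) → Initial t₀ → InP t₀ t → InB4 t)
    × ((t₀ t₀′ t : Quad) → Initial t₀ → Initial t₀′ → InP t₀ t → InP t₀′ t → t₀ ≡ t₀′)
    × ((t : Quad) → InB4 t → ∃[ t₀ ] (Initial t₀ × InP t₀ t))
lemma5p7 =
  InP⇒InB4 ,
  (λ _ _ _ t₀-init t₀′-init t∈P t∈P′ →
     trans (sym (InP⇒initialOf t₀-init t∈P)) (InP⇒initialOf t₀′-init t∈P′)) ,
  (λ t t∈B → initialOf (shape t) , InB4⇒InP-initialOf t∈B)
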